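{- For a positive integer $n$, let $z(n)$ be the largest integer with $3z(n)<2n$, let $m(n)$ be the largest integer with $m(n)^2\le 2n$, and put $$y(n)=2^{2n-2z(n)-m(n)+2}-n^{m(n)-1}.$$ Then: (i) $y(n)<0$ if and only if either $5\le n\le 335$ or $338\le n\le 350$ or $365\le n\le 368$; (ii) $y(n)\ne 0$ for every positive integer $n$; (iii) $y(n)>0$ if and only if either $1\le n\le 4$ or $336\le n\le 337$ or $351\le n\le 364$ or $n\ge 369$.
   Context: All variables range over positive integers. The exponent $2n-2z(n)-m(n)+2$ is always an integer $\ge 2$, so $y(n)$ is an integer. -}

module Defs where

open import Data.Nat using (ℕ; zero; suc; _+_; _*_; _∸_; _^_; _<_; _≤_; _<?_; _≤?_)
open import Data.Integer as ℤ using (ℤ; +_)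
open import Relation.Nullary.Decidable using (does)
open import Data.Bool using (if_then_else_)

largestBelow : (ℕ → Data.Bool.Bool) → ℕ → ℕ
largestBelow p zero = zero
largestBelow p (suc b) = if p (suc b) then suc b else largestBelow p b

-- z(n): the largest integer z with 3z < 2n.  (Any such z satisfies z ≤ 2n.)
z : ℕ → ℕ
z n = largestBelow (λ k → does (3 * k <? 2 * n)) (2 * n)

-- m(n): the largest integer m with m² ≤ 2n.  (Any such m satisfies m ≤ 2n.)
m : ℕ → ℕ
m n = largestBelow (λ k → does (k * k ≤? 2 * n)) (2 * n)

-- y(n) = 2^(2n - 2z(n) - m(n) + 2) - n^(m(n) - 1), as an integer.
-- The exponent 2n - 2z - m + 2 is ≥ 2 for n ≥ 1, so truncated subtraction is exact there.
y : ℕ → ℤ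
y n = (+ (2 ^ ((2 * n + 2) ∸ (2 * z n + m n)))) ℤ.- (+ (n ^ (m n ∸ 1)))

-- For n ≤ 544 the sign of y(n) is settled by evaluation.  For larger n write
-- m = m(n) = k + 2, so k ≥ 31.  From 3z(n) < 2n and m² ≤ 2n the exponent
-- E = 2n - 2z(n) - m + 2 of the power of two satisfies 3E > k(k+1), while
-- 2n < (m+1)² gives n³ ≤ (k+3)⁶ ≤ 2ᵏ.  Hence
-- (n^(m-1))³ = (n³)^(k+1) ≤ 2^(k(k+1)) < (2^E)³, and y(n) > 0.
module Submission where

open import Defs
open import Data.Nat using (ℕ; _≤_; _≥_)
open import Data.Integer as ℤ using (ℤ; _<_; _>_; 0ℤ)
open import Data.Product using (_×_)
open import Data.Sum using (_⊎_)
open import Function.Bundles using (_⇔_)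
open import Relation.Binary.PropositionalEquality using (_≢_)

import Data.Nat as ℕ
open import Data.Nat using (NonZero; zero; suc; _+_; _*_; _∸_; _^_; _≤?_; _<?_; z≤n; s≤s; _≤′_; ≤′-refl; ≤′-step)
open import Data.Nat.Properties
  using ( ≤-trans; ≤-<-trans; <⇒≤; <⇒≱; ≰⇒>; <-irrefl; m≤n⇒m<n∨m≡n; ≤ᵇ⇒≤; ≤⇒≤′; ≤′⇒≤
        ; m≤m+n; m<n+m; m≤m*n; *-assoc; +-comm; +-monoˡ-≤; +-mono-≤; *-monoʳ-≤; *-monoˡ-≤; *-cancelˡ-≤; *-suc; *-comm
        ; m+n≤o⇒m≤o∸n; *-distribˡ-∸; m^n≢0; ^-monoˡ-≤; ^-monoʳ-<; ^-*-assoc; ^-distribˡ-+-*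
        ; allUpTo?; +-*-commutativeSemiring; module ≤-Reasoning )
open import Data.Nat.Tactic.RingSolver using (solve)
open import Data.List using (_∷_; [])
open import Algebra.Properties.CommutativeSemiring.Exp +-*-commutativeSemiring using (^-distrib-*)
import Data.Integer.Properties as ℤ
open import Data.Unit using (tt)
open import Data.Empty using (⊥-elim)
open import Data.Product using (_,_; proj₁; proj₂; uncurry)
open import Data.Sum using (inj₁; inj₂)
open import Function.Base using (_∘_)
open import Function.Bundles using (mk⇔; module Equivalence)
open import Relation.Nullary using (Dec; does; yes; no)
import Relation.Unary as U
open import Relation.Nullary.Decidable using (map′; _×-dec_; _⊎-dec_; _→-dec_; ¬?; toWitness)
open import Relation.Binary.PropositionalEquality using (refl; sym; cong; subst)

module _ {P : ℕ → Set} (P? : U.Decidable P) where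

  largestBelow-satisfies : ∀ {k} b → k ≤ b → P k → P (largestBelow (λ i → does (P? i)) b)
  largestBelow-satisfies zero    z≤n   Pk = Pk
  largestBelow-satisfies (suc b) k≤1+b Pk with P? (suc b) | m≤n⇒m<n∨m≡n k≤1+b
  ... | yes P[1+b] | _              = P[1+b]
  ... | no _       | inj₁ (s≤s k≤b) = largestBelow-satisfies b k≤b Pk
  ... | no ¬P[1+b] | inj₂ refl      = ⊥-elim (¬P[1+b] Pk)

  largestBelow-maximal : ∀ {k} b → k ≤ b → P k → k ≤ largestBelow (λ i → does (P? i)) b
  largestBelow-maximal zero    k≤0   _  = k≤0
  largestBelow-maximal (suc b) k≤1+b Pk with P? (suc b) | m≤n⇒m<n∨m≡n k≤1+b
  ... | yes _      | _              = k≤1+b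
  ... | no _       | inj₁ (s≤s k≤b) = largestBelow-maximal b k≤b Pk
  ... | no ¬P[1+b] | inj₂ refl      = ⊥-elim (¬P[1+b] Pk)

^-cancelʳ-< : ∀ {a b} e → a ^ e ℕ.< b ^ e → a ℕ.< b
^-cancelʳ-< e aᵉ<bᵉ = ≰⇒> (λ b≤a → <⇒≱ aᵉ<bᵉ (^-monoˡ-≤ e b≤a))

-- ^-distrib-* is about the semiring power, which coincides with ℕ's _^_ only at a literal exponent.
[1+x]^6≤2*x^6 : ∀ {c d x} .{{_ : NonZero d}} → d * suc x ≤ c * x → c ^ 6 ≤ 2 * d ^ 6 →
                suc x ^ 6 ≤ 2 * x ^ 6
[1+x]^6≤2*x^6 {c} {d} {x} d[1+x]≤cx c⁶≤2d⁶ = *-cancelˡ-≤ (d ^ 6) {{m^n≢0 d 6}} (begin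
  d ^ 6 * suc x ^ 6     ≡⟨ ^-distrib-* d (suc x) 6 ⟨
  (d * suc x) ^ 6       ≤⟨ ^-monoˡ-≤ 6 d[1+x]≤cx ⟩
  (c * x) ^ 6           ≡⟨ ^-distrib-* c x 6 ⟩
  c ^ 6 * x ^ 6         ≤⟨ *-monoˡ-≤ (x ^ 6) c⁶≤2d⁶ ⟩
  2 * d ^ 6 * x ^ 6     ≡⟨ cong (_* x ^ 6) (*-comm 2 (d ^ 6)) ⟩
  d ^ 6 * 2 * x ^ 6     ≡⟨ *-assoc (d ^ 6) 2 (x ^ 6) ⟩
  d ^ 6 * (2 * x ^ 6)   ∎)
  where open ≤-Reasoning

[k+3]^6≤2^k : ∀ {k} → 31 ≤ k → (k + 3) ^ 6 ≤ 2 ^ k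
[k+3]^6≤2^k 31≤k = go (≤⇒≤′ 31≤k)
  where
  10[1+x]≤11x : ∀ {x} → 10 ≤ x → 10 * suc x ≤ 11 * x
  10[1+x]≤11x {x} 10≤x = begin
    10 * suc x   ≡⟨ *-suc 10 x ⟩
    10 + 10 * x  ≤⟨ +-monoˡ-≤ (10 * x) 10≤x ⟩
    x + 10 * x   ∎
    where open ≤-Reasoning

  go : ∀ {k} → 31 ≤′ k → (k + 3) ^ 6 ≤ 2 ^ k
  go ≤′-refl                 = ≤ᵇ⇒≤ (34 ^ 6) (2 ^ 31) tt
  go {suc k} (≤′-step 31≤′k) = ≤-trans
    ([1+x]^6≤2*x^6 {11} {10} {k + 3}
      (10[1+x]≤11x (≤-trans (≤ᵇ⇒≤ 10 34 tt) (+-monoˡ-≤ 3 (≤′⇒≤ 31≤′k))))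
      (≤ᵇ⇒≤ (11 ^ 6) (2 * 10 ^ 6) tt))
    (*-monoʳ-≤ 2 (go 31≤′k))

0<+m-+n : ∀ {m n} → n ℕ.< m → 0ℤ < ℤ.+ m ℤ.- ℤ.+ n
0<+m-+n {m} {n} n<m = begin-strict
  0ℤ              ≡⟨ ℤ.n⊖n≡0 m ⟨
  m ℤ.⊖ m         <⟨ ℤ.⊖-monoʳ->-< m n<m ⟩
  m ℤ.⊖ n         ≡⟨ ℤ.[+m]-[+n]≡m⊖n m n ⟨
  ℤ.+ m ℤ.- ℤ.+ n ∎
  where open ℤ.≤-Reasoning

infix 2 _⇔?_
_⇔?_ : {A B : Set} → Dec A → Dec B → Dec (A ⇔ B)
a? ⇔? b? = map′ (uncurry mk⇔) (λ A⇔B → Equivalence.to A⇔B , Equivalence.from A⇔B)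
                ((a? →-dec b?) ×-dec (b? →-dec a?))

3*z<2*n : ∀ {n} → 1 ≤ n → 3 * z n ℕ.< 2 * n
3*z<2*n {n} 1≤n = largestBelow-satisfies (λ k → 3 * k <? 2 * n) (2 * n) z≤n (≤-trans 1≤n (m≤m+n n (n + 0)))

m*m≤2*n : ∀ n → m n * m n ≤ 2 * n
m*m≤2*n n = largestBelow-satisfies (λ k → k * k ≤? 2 * n) (2 * n) z≤n z≤n

k*k≤2*n⇒k≤m : ∀ {k n} → k * k ≤ 2 * n → k ≤ m n
k*k≤2*n⇒k≤m {zero}  _     = z≤n
k*k≤2*n⇒k≤m {suc k} {n} k*k≤2n =
  largestBelow-maximal (λ k → k * k ≤? 2 * n) (2 * n) (≤-trans (m≤m*n (suc k) (suc k)) k*k≤2n) k*k≤2n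

2*n<[1+m]² : ∀ n → 2 * n ℕ.< suc (m n) * suc (m n)
2*n<[1+m]² n = ≰⇒> (λ [1+m]²≤2n → <-irrefl refl (k*k≤2*n⇒k≤m {n = n} [1+m]²≤2n))

33≤m : ∀ {n} → 545 ≤ n → 33 ≤ m n
33≤m {n} 545≤n = k*k≤2*n⇒k≤m {n = n} (≤-trans (≤ᵇ⇒≤ (33 * 33) (2 * 545) tt) (*-monoʳ-≤ 2 545≤n))

k[1+k]<3*exponent : ∀ {n z k} → 3 * z ℕ.< 2 * n → (2 + k) * (2 + k) ≤ 2 * n →
                    k * (1 + k) ℕ.< 3 * ((2 * n + 2) ∸ (2 * z + (2 + k)))
k[1+k]<3*exponent {n} {z} {k} 3z<2n m²≤2n =
  subst (k * (1 + k) ℕ.<_) (sym (*-distribˡ-∸ 3 (2 * n + 2) (2 * z + (2 + k))))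
        (m+n≤o⇒m≤o∸n (suc (k * (1 + k))) bound)
  where
  open ≤-Reasoning
  bound : k * (1 + k) + 3 * (2 * z + (2 + k)) ℕ.< 3 * (2 * n + 2)
  bound = begin-strict
    k * (1 + k) + 3 * (2 * z + (2 + k))  ≡⟨ solve (k ∷ z ∷ []) ⟩
    (2 + k) * (2 + k) + 2 * (1 + 3 * z)   ≤⟨ +-mono-≤ m²≤2n (*-monoʳ-≤ 2 3z<2n) ⟩
    2 * n + 2 * (2 * n)                   <⟨ m<n+m (2 * n + 2 * (2 * n)) {6} (s≤s z≤n) ⟩
    6 + (2 * n + 2 * (2 * n))             ≡⟨ solve (n ∷ []) ⟩
    3 * (2 * n + 2)                       ∎

n^[m-1]<2^exponent : ∀ {n z m} → 3 * z ℕ.< 2 * n → m * m ≤ 2 * n → 2 * n ℕ.< suc m * suc m → 33 ≤ m →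
                     n ^ (m ∸ 1) ℕ.< 2 ^ ((2 * n + 2) ∸ (2 * z + m))
n^[m-1]<2^exponent {n} {z} {suc (suc k)} 3z<2n m²≤2n 2n<[1+m]² (s≤s (s≤s 31≤k)) = ^-cancelʳ-< 3 (begin-strict
  (n ^ suc k) ^ 3    ≡⟨ ^-*-assoc n (suc k) 3 ⟩
  n ^ (suc k * 3)    ≡⟨ cong (n ^_) (*-comm (suc k) 3) ⟩
  n ^ (3 * suc k)    ≡⟨ ^-*-assoc n 3 (suc k) ⟨
  (n ^ 3) ^ suc k    ≤⟨ ^-monoˡ-≤ (suc k) n³≤2^k ⟩
  (2 ^ k) ^ suc k    ≡⟨ ^-*-assoc 2 k (suc k) ⟩
  2 ^ (k * suc k)    <⟨ ^-monoʳ-< 2 (s≤s (s≤s z≤n)) (k[1+k]<3*exponent {n} {z} 3z<2n m²≤2n) ⟩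
  2 ^ (3 * E)        ≡⟨ cong (2 ^_) (*-comm 3 E) ⟩
  2 ^ (E * 3)        ≡⟨ ^-*-assoc 2 E 3 ⟨
  (2 ^ E) ^ 3        ∎)
  where
  open ≤-Reasoning
  E : ℕ
  E = (2 * n + 2) ∸ (2 * z + suc (suc k))

  n³≤2^k : n ^ 3 ≤ 2 ^ k
  n³≤2^k = begin
    n ^ 3                        ≤⟨ ^-monoˡ-≤ 3 (<⇒≤ (≤-<-trans (m≤m+n n (n + 0)) 2n<[1+m]²)) ⟩
    ((3 + k) * (3 + k)) ^ 3      ≡⟨ ^-distrib-* (3 + k) (3 + k) 3 ⟩
    (3 + k) ^ 3 * (3 + k) ^ 3    ≡⟨ ^-distribˡ-+-* (3 + k) 3 3 ⟨
    (3 + k) ^ 6                  ≡⟨ cong (_^ 6) (+-comm 3 k) ⟩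
    (k + 3) ^ 6                  ≤⟨ [k+3]^6≤2^k 31≤k ⟩
    2 ^ k                        ∎

y-positive : ∀ {n} → 545 ≤ n → 0ℤ < y n
y-positive {n} 545≤n =
  0<+m-+n (n^[m-1]<2^exponent {n} {z n} (3*z<2*n (≤-trans (s≤s z≤n) 545≤n)) (m*m≤2*n n) (2*n<[1+m]² n) (33≤m 545≤n))

NegativeRange PositiveRange : ℕ → Set
NegativeRange n = (5 ≤ n × n ≤ 335) ⊎ (338 ≤ n × n ≤ 350) ⊎ (365 ≤ n × n ≤ 368)
PositiveRange n = (1 ≤ n × n ≤ 4) ⊎ (336 ≤ n × n ≤ 337) ⊎ (351 ≤ n × n ≤ 364) ⊎ n ≥ 369

negativeRange? : ∀ n → Dec (NegativeRange n)
negativeRange? n = (5 ≤? n ×-dec n ≤? 335) ⊎-dec (338 ≤? n ×-dec n ≤? 350) ⊎-dec (365 ≤? n ×-dec n ≤? 368)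

positiveRange? : ∀ n → Dec (PositiveRange n)
positiveRange? n =
  (1 ≤? n ×-dec n ≤? 4) ⊎-dec (336 ≤? n ×-dec n ≤? 337) ⊎-dec (351 ≤? n ×-dec n ≤? 364) ⊎-dec 369 ≤? n

negativeRange⇒≤368 : ∀ {n} → NegativeRange n → n ≤ 368
negativeRange⇒≤368 (inj₁ (_ , n≤335))        = ≤-trans n≤335 (≤ᵇ⇒≤ 335 368 tt)
negativeRange⇒≤368 (inj₂ (inj₁ (_ , n≤350))) = ≤-trans n≤350 (≤ᵇ⇒≤ 350 368 tt)
negativeRange⇒≤368 (inj₂ (inj₂ (_ , n≤368))) = n≤368

-- The value is a separate argument so that deciding SignPattern (y n) n evaluates y n only once.
SignPattern : ℤ → ℕ → Set
SignPattern v n = (v < 0ℤ ⇔ NegativeRange n) × v ≢ 0ℤ × (v > 0ℤ ⇔ PositiveRange n)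

signPattern? : ∀ v n → Dec (SignPattern v n)
signPattern? v n = (v ℤ.<? 0ℤ ⇔? negativeRange? n) ×-dec ¬? (v ℤ.≟ 0ℤ) ×-dec (0ℤ ℤ.<? v ⇔? positiveRange? n)

signPattern-positive : ∀ {v n} → 369 ≤ n → 0ℤ < v → SignPattern v n
signPattern-positive 369≤n 0<v =
    mk⇔ (⊥-elim ∘ ℤ.<-asym 0<v) (⊥-elim ∘ <⇒≱ 369≤n ∘ negativeRange⇒≤368)
  , (λ v≡0 → ℤ.<⇒≢ 0<v (sym v≡0))
  , mk⇔ (λ _ → inj₂ (inj₂ (inj₂ 369≤n))) (λ _ → 0<v)

signPattern-below-545 : ∀ {n} → 1 ≤ n → n ℕ.< 545 → SignPattern (y n) n
signPattern-below-545 1≤n n<545 =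
  toWitness {a? = allUpTo? (λ n → 1 ≤? n →-dec signPattern? (y n) n) 545} tt n<545 1≤n

signPattern : ∀ n → 1 ≤ n → SignPattern (y n) n
signPattern n 1≤n with 545 ≤? n
... | yes 545≤n = signPattern-positive (≤-trans (≤ᵇ⇒≤ 369 545 tt) 545≤n) (y-positive 545≤n)
... | no  545≰n = signPattern-below-545 1≤n (≰⇒> 545≰n)

theorem2p7 : (∀ (n : ℕ) → 1 ≤ n →
                (y n < 0ℤ ⇔ ((5 ≤ n × n ≤ 335) ⊎ (338 ≤ n × n ≤ 350) ⊎ (365 ≤ n × n ≤ 368))))
           × (∀ (n : ℕ) → 1 ≤ n → y n ≢ 0ℤ)
           × (∀ (n : ℕ) → 1 ≤ n →
                (y n > 0ℤ ⇔ ((1 ≤ n × n ≤ 4) ⊎ (336 ≤ n × n ≤ 337) ⊎ (351 ≤ n × n ≤ 364) ⊎ n ≥ 369)))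
theorem2p7 = (λ n 1≤n → proj₁ (signPattern n 1≤n))
           , (λ n 1≤n → proj₁ (proj₂ (signPattern n 1≤n)))
           , (λ n 1≤n → proj₂ (proj₂ (signPattern n 1≤n)))
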